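{- Let $(X,\mathcal{C})$ be an instance of 5-Double-Sat satisfying the standing assumptions in the context, and let $G=(V,E)$ be the graph constructed from it as in the context. Then (1) $d_G(r',y)>3$, (2) $d_G(r,y)>3$, (3) $d_G(r,v_{C,j})>3$ for each $j$ with $1\le j\le p$, and (4) $d_G(r,r'_F)>3$ and $d_G(r,r'_T)>3$.
   Context: 5-Double-Sat instance: variables $X=\{x_1,\dots,x_q\}$, clauses $\mathcal{C}=\{C_1,\dots,C_p\}$, each clause containing exactly five literals and not containing both a variable and its negation. A clause is double-satisfied by an assignment if it contains a positive literal and a negative literal both made true. Standing assumptions: each clause contains at least one positive and at least one negative literal; each variable occurs as a positive literal in some clause and as a negative literal in some clause; it is not possible to double-satisfy all clauses by setting at most two variables to true or to false. Construction of $G$: $V=\{r,r',r_T,r'_T,r^*_T,r_F,r'_F,y_1,y_2,y\}\cup\{x^T_{i,1},x^T_{i,2},x^F_i : 1\le i\le q\}\cup\{v_{C,j}:1\le j\le p\}$. Edges: $\{r,r'\},\{r',r_T\},\{r',r^*_T\},\{r',r_F\}$; for each $i$: $\{r_T,x^T_{i,1}\},\{r'_T,x^T_{i,1}\},\{x^T_{i,1},x^T_{i,2}\},\{r^*_T,x^T_{i,2}\},\{y_1,x^T_{i,2}\},\{r_F,x^F_i\},\{r'_F,x^F_i\}$; $\{x^T_{i,2},x^F_j\}$ for all $i\ne j$; $\{x^T_{i,1},v_{C,j}\}$ whenever $x_i\in C_j$; $\{x^F_i,v_{C,j}\}$ whenever $\overline{x_i}\in C_j$; $\{v_{C,j},y\}$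 for all $j$; and $\{y,y_2\},\{y_1,y_2\},\{y_1,r'_T\},\{y_1,r'_F\}$. No other edges. $d_G$ is the shortest-path distance in $G$. -}

module Defs where

open import Data.Nat using (ℕ; zero; suc; _≤_)
open import Data.Fin using (Fin)
open import Data.Fin.Subset using (Subset; ∣_∣; ∁)
open import Data.Bool using (Bool; true; false)
open import Data.Vec using (lookup)
open import Data.Product using (Σ; ∃; ∃-syntax; _×_; _,_)
open import Data.Sum using (_⊎_)
open import Function.Definitions using (Injective)
open import Relation.Binary.PropositionalEquality using (_≡_)
open import Relation.Nullary using (¬_)

-- A literal over variables x_1..x_q : (i , true) is x_i, (i , false) is ¬x_i.
Lit : ℕ → Set
Lit q = Fin q × Bool

record Instance (q p : ℕ) : Set where
  field
    clause   : Fin p → Fin 5 → Lit q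
    distinct : ∀ j → Injective _≡_ _≡_ (clause j)

open Instance public


InC : ∀ {q p} (I : Instance q p) → Lit q → Fin p → Set
InC I l j = ∃[ k ] clause I j k ≡ l

-- Assignments: a subset of variables (those set to true).
Assignment : ℕ → Set
Assignment q = Subset q

DoubleSat : ∀ {q p} (I : Instance q p) → Assignment q → Fin p → Set
DoubleSat I a j =
  (∃[ i ] InC I (i , true) j × lookup a i ≡ true) ×
  (∃[ k ] InC I (k , false) j × lookup a k ≡ false)

AllDoubleSat : ∀ {q p} (I : Instance q p) → Assignment q → Set
AllDoubleSat I a = ∀ j → DoubleSat I a j

record Standing {q p : ℕ} (I : Instance q p) : Set where
  field
    noComplementary : ∀ j i → ¬ (InC I (i , true) j × InC I (i , false) j)
    hasPos          : ∀ j → ∃[ i ] InC I (i , true) j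
    hasNeg          : ∀ j → ∃[ i ] InC I (i , false) j
    occursPos       : ∀ i → ∃[ j ] InC I (i , true) j
    occursNeg       : ∀ i → ∃[ j ] InC I (i , false) j
    notTwoTrue      : ∀ (a : Assignment q) → ∣ a ∣ ≤ 2 → ¬ AllDoubleSat I a
    notTwoFalse     : ∀ (a : Assignment q) → ∣ ∁ a ∣ ≤ 2 → ¬ AllDoubleSat I a

data V (q p : ℕ) : Set where
  r r' rT rT' rT* rF rF' y₁ y₂ y : V q p
  xT1 xT2 xF : Fin q → V q p
  vC : Fin p → V q p

-- Edges, each listed once (in one orientation).
data E {q p : ℕ} (I : Instance q p) : V q p → V q p → Set where
  e-r-r'     : E I r r'
  e-r'-rT    : E I r' rT
  e-r'-rT*   : E I r' rT*
  e-r'-rF    : E I r' rF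
  e-rT-x1    : ∀ i → E I rT (xT1 i)
  e-rT'-x1   : ∀ i → E I rT' (xT1 i)
  e-x1-x2    : ∀ i → E I (xT1 i) (xT2 i)
  e-rT*-x2   : ∀ i → E I rT* (xT2 i)
  e-y1-x2    : ∀ i → E I y₁ (xT2 i)
  e-rF-xF    : ∀ i → E I rF (xF i)
  e-rF'-xF   : ∀ i → E I rF' (xF i)
  e-x2-xF    : ∀ i j → ¬ (i ≡ j) → E I (xT2 i) (xF j)
  e-x1-v     : ∀ i j → InC I (i , true) j → E I (xT1 i) (vC j)
  e-xF-v     : ∀ i j → InC I (i , false) j → E I (xF i) (vC j)
  e-v-y      : ∀ j → E I (vC j) y
  e-y-y2     : E I y y₂
  e-y1-y2    : E I y₁ y₂
  e-y1-rT'   : E I y₁ rT'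
  e-y1-rF'   : E I y₁ rF'

Adj : ∀ {q p} (I : Instance q p) → V q p → V q p → Set
Adj I u v = E I u v ⊎ E I v u

data Walk {q p : ℕ} (I : Instance q p) : V q p → V q p → ℕ → Set where
  [] : ∀ {u} → Walk I u u zero
  _∷_ : ∀ {u v w n} → Adj I u v → Walk I v w n → Walk I u w (suc n)

DistLe : ∀ {q p} (I : Instance q p) → V q p → V q p → ℕ → Set
DistLe I u v k = ∃[ n ] n ≤ k × Walk I u v n

-- d_G(u,v) > k  (includes d_G(u,v) = ∞)
DistGt : ∀ {q p} (I : Instance q p) → V q p → V q p → ℕ → Set
DistGt I u v k = ¬ DistLe I u v k

module Submission where

-- All four claims are lower bounds on distances in G, and a
-- lower bound on d_G(s,·) is certified by a potential: a labelling
-- ℓ : V → ℕ whose values at the two ends of every edge differ by at most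
-- one.  Along a walk of length n from u to w the potential grows by at most
-- n, so d_G(u,w) ≥ ℓ w ∸ ℓ u (lemma 'distGt-of-potential').
--
-- The theorem then needs two explicit potentials, each the actual
-- distance from the source capped at 4 (only the lower bound is used):
--   * 'fromR'  (source r):  r ↦ 0, r' ↦ 1, r_T r*_T r_F ↦ 2,
--                           x^T_{i,1} x^T_{i,2} x^F_i ↦ 3, all else ↦ 4;
--   * 'fromR'' (source r'): r' ↦ 0, r r_T r*_T r_F ↦ 1, the x-vertices ↦ 2,
--                           r'_T r'_F y₁ v_{C,j} ↦ 3, y y₂ ↦ 4.
-- Checking the edge condition is a finite case analysis over the edge
-- types.  Claims (2)-(4) read off 'fromR' and claim (1) reads off 'fromR''.

open import Defs
open import Data.Nat using (ℕ; suc; _+_; _≤_; _<_; _≤ᵇ_)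
open import Data.Nat.Properties using (≤ᵇ⇒≤; ≤-refl; m≤m+n; +-suc; +-monoˡ-≤; +-monoʳ-≤; <⇒≱; module ≤-Reasoning)
open import Data.Bool using (T)
open import Data.Fin using (Fin)
open import Data.Unit using (tt)
open import Data.Product using (_×_; _,_; proj₁; proj₂)
open import Data.Sum using (inj₁; inj₂)

-- Two natural numbers differ by at most one; stated with the boolean
-- comparison so that it holds by computation for concrete numbers.
Close : ℕ → ℕ → Set
Close m n = T (m ≤ᵇ suc n) × T (n ≤ᵇ suc m)

module _ {q p : ℕ} (I : Instance q p) where

  IsPotential : (V q p → ℕ) → Set
  IsPotential ℓ = ∀ {u v} → E I u v → Close (ℓ u) (ℓ v)

  step-bound : ∀ ℓ → IsPotential ℓ → ∀ {u v} → Adj I u v → ℓ v ≤ suc (ℓ u)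
  step-bound ℓ pot {u} {v} (inj₁ e) = ≤ᵇ⇒≤ (ℓ v) (suc (ℓ u)) (proj₂ (pot e))
  step-bound ℓ pot {u} {v} (inj₂ e) = ≤ᵇ⇒≤ (ℓ v) (suc (ℓ u)) (proj₁ (pot e))

  walk-bound : ∀ ℓ → IsPotential ℓ → ∀ {u w n} → Walk I u w n → ℓ w ≤ ℓ u + n
  walk-bound ℓ pot {u} [] = m≤m+n (ℓ u) 0
  walk-bound ℓ pot {u} {w} {suc n} (_∷_ {v = v} a walk) = begin
    ℓ w            ≤⟨ walk-bound ℓ pot walk ⟩
    ℓ v + n        ≤⟨ +-monoˡ-≤ n (step-bound ℓ pot a) ⟩
    suc (ℓ u) + n  ≡⟨ +-suc (ℓ u) n ⟨
    ℓ u + suc n    ∎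
    where open ≤-Reasoning

  distGt-of-potential : ∀ ℓ → IsPotential ℓ → ∀ {u w} k → ℓ u + k < ℓ w → DistGt I u w k
  distGt-of-potential ℓ pot {u} {w} k gap (n , n≤k , walk) = <⇒≱ gap (begin
    ℓ w      ≤⟨ walk-bound ℓ pot walk ⟩
    ℓ u + n  ≤⟨ +-monoʳ-≤ (ℓ u) n≤k ⟩
    ℓ u + k  ∎)
    where open ≤-Reasoning

fromR : ∀ {q p} → V q p → ℕ
fromR r       = 0
fromR r'      = 1
fromR rT      = 2
fromR rT*     = 2
fromR rF      = 2
fromR (xT1 _) = 3
fromR (xT2 _) = 3
fromR (xF _)  = 3
fromR _       = 4

fromR-potential : ∀ {q p} (I : Instance q p) → IsPotential I fromR
fromR-potential I e-r-r'             = tt , tt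
fromR-potential I e-r'-rT            = tt , tt
fromR-potential I e-r'-rT*           = tt , tt
fromR-potential I e-r'-rF            = tt , tt
fromR-potential I (e-rT-x1 _)        = tt , tt
fromR-potential I (e-rT'-x1 _)       = tt , tt
fromR-potential I (e-x1-x2 _)        = tt , tt
fromR-potential I (e-rT*-x2 _)       = tt , tt
fromR-potential I (e-y1-x2 _)        = tt , tt
fromR-potential I (e-rF-xF _)        = tt , tt
fromR-potential I (e-rF'-xF _)       = tt , tt
fromR-potential I (e-x2-xF _ _ _)    = tt , tt
fromR-potential I (e-x1-v _ _ _)     = tt , tt
fromR-potential I (e-xF-v _ _ _)     = tt , tt
fromR-potential I (e-v-y _)          = tt , tt
fromR-potential I e-y-y2             = tt , tt
fromR-potential I e-y1-y2            = tt , tt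
fromR-potential I e-y1-rT'           = tt , tt
fromR-potential I e-y1-rF'           = tt , tt

fromR' : ∀ {q p} → V q p → ℕ
fromR' r'      = 0
fromR' r       = 1
fromR' rT      = 1
fromR' rT*     = 1
fromR' rF      = 1
fromR' (xT1 _) = 2
fromR' (xT2 _) = 2
fromR' (xF _)  = 2
fromR' rT'     = 3
fromR' rF'     = 3
fromR' y₁      = 3
fromR' (vC _)  = 3
fromR' y       = 4
fromR' y₂      = 4

fromR'-potential : ∀ {q p} (I : Instance q p) → IsPotential I fromR'
fromR'-potential I e-r-r'            = tt , tt
fromR'-potential I e-r'-rT           = tt , tt
fromR'-potential I e-r'-rT*          = tt , tt
fromR'-potential I e-r'-rF           = tt , tt
fromR'-potential I (e-rT-x1 _)       = tt , tt
fromR'-potential I (e-rT'-x1 _)      = tt , tt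
fromR'-potential I (e-x1-x2 _)       = tt , tt
fromR'-potential I (e-rT*-x2 _)      = tt , tt
fromR'-potential I (e-y1-x2 _)       = tt , tt
fromR'-potential I (e-rF-xF _)       = tt , tt
fromR'-potential I (e-rF'-xF _)      = tt , tt
fromR'-potential I (e-x2-xF _ _ _)   = tt , tt
fromR'-potential I (e-x1-v _ _ _)    = tt , tt
fromR'-potential I (e-xF-v _ _ _)    = tt , tt
fromR'-potential I (e-v-y _)         = tt , tt
fromR'-potential I e-y-y2            = tt , tt
fromR'-potential I e-y1-y2           = tt , tt
fromR'-potential I e-y1-rT'          = tt , tt
fromR'-potential I e-y1-rF'          = tt , tt

-- Each claimed bound is a gap 0 + 3 < 4 in one of the two potentials.
lemma4 : ∀ {q p : ℕ} (I : Instance q p) → Standing I →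
    DistGt I r' y 3 ×
    DistGt I r y 3 ×
    (∀ (j : Fin p) → DistGt I r (vC j) 3) ×
    (DistGt I r rF' 3 × DistGt I r rT' 3)
lemma4 I _ =
  farFrom-r' ≤-refl ,
  farFrom-r ≤-refl ,
  (λ _ → farFrom-r ≤-refl) ,
  farFrom-r ≤-refl ,
  farFrom-r ≤-refl
  where
  farFrom-r : ∀ {w} → 3 < fromR w → DistGt I r w 3
  farFrom-r = distGt-of-potential I fromR (fromR-potential I) 3

  farFrom-r' : ∀ {w} → 3 < fromR' w → DistGt I r' w 3
  farFrom-r' = distGt-of-potential I fromR' (fromR'-potential I) 3
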